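{- Let $n\geq 1$ and $1\leq r\leq n$, and let $G$ be a disjoint union of $n$ complete graphs, each having at least $2$ vertices. If $(\mathcal{A},\mathcal{B})$ is a cross-intersecting pair in $\mathcal{J}^r(G)$, then $|\mathcal{A}|+|\mathcal{B}|\leq |\mathcal{J}^r(G)|$. This bound is best possible, and is attained by $\mathcal{A}=\mathcal{J}^r(G)$ and $\mathcal{B}=\emptyset$.
   Context: For a graph $G$, $\mathcal{J}^r(G)$ denotes the family of all independent vertex sets of size $r$ in $G$. A pair $(\mathcal{A},\mathcal{B})$ of families is a cross-intersecting pair in $\mathcal{J}^r(G)$ if $\mathcal{A},\mathcal{B}\subseteq\mathcal{J}^r(G)$ and $A\cap B\neq\emptyset$ for every $A\in\mathcal{A}$ and $B\in\mathcal{B}$ (the families need not be non-empty or intersecting themselves). -}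

module Defs where

open import Data.Nat using (ℕ; suc; _≤_; _+_)
open import Data.Bool using (Bool; true; false; T)
open import Data.Fin using (Fin; _≟_)
open import Data.Fin.Subset using (Subset; _∈_; _∩_; ∣_∣; Nonempty)
open import Data.Fin.Subset.Properties using (_∈?_)
open import Data.Fin.Properties using (all?)
open import Data.Vec using ([]; _∷_)
open import Data.List using (List; []; _∷_; map; _++_; length; filter; filterᵇ)
open import Data.Product using (_×_; ∃; ∃-syntax; _,_)
open import Relation.Binary.PropositionalEquality using (_≡_; _≢_)
open import Relation.Nullary using (Dec; ¬_; ¬?)
open import Relation.Nullary.Decidable using (_→-dec_; _×-dec_)
open import Data.Nat.Properties using () renaming (_≟_ to _≟ℕ_)

allSubsets : (N : ℕ) → List (Subset N)
allSubsets ℕ.zero = [] ∷ []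
allSubsets (suc N) = map (true ∷_) (allSubsets N) ++ map (false ∷_) (allSubsets N)

-- The graph G = disjoint union of complete graphs, on vertex set Fin N,
-- given by a clique-assignment c : Fin N → Fin n: distinct vertices are
-- adjacent iff they lie in the same clique.
Adj : ∀ {N n} → (Fin N → Fin n) → Fin N → Fin N → Set
Adj c u v = (u ≢ v) × (c u ≡ c v)

EachCliqueHasTwoVertices : ∀ {N n} → (Fin N → Fin n) → Set
EachCliqueHasTwoVertices {N} {n} c =
  (i : Fin n) → ∃[ u ] ∃[ v ] (u ≢ v × c u ≡ i × c v ≡ i)

Independent : ∀ {N n} → (Fin N → Fin n) → Subset N → Set
Independent c S = ∀ u v → u ∈ S → v ∈ S → ¬ Adj c u v

InJ : ∀ {N n} → ℕ → (Fin N → Fin n) → Subset N → Set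
InJ r c S = Independent c S × (∣ S ∣ ≡ r)

InJ? : ∀ {N n} (r : ℕ) (c : Fin N → Fin n) (S : Subset N) → Dec (InJ r c S)
InJ? r c S =
  all? (λ u → all? (λ v → (u ∈? S) →-dec ((v ∈? S) →-dec
     ¬? ((¬? (u ≟ v)) ×-dec (c u ≟ c v)))))
  ×-dec (∣ S ∣ ≟ℕ r)

sizeJ : ∀ {N n} → ℕ → (Fin N → Fin n) → ℕ
sizeJ {N} r c = length (filter (InJ? r c) (allSubsets N))

Family : ℕ → Set
Family N = Subset N → Bool

size : ∀ {N} → Family N → ℕ
size {N} 𝒜 = length (filterᵇ 𝒜 (allSubsets N))

FamilyInJ : ∀ {N n} → ℕ → (Fin N → Fin n) → Family N → Set
FamilyInJ r c 𝒜 = ∀ S → T (𝒜 S) → InJ r c S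

CrossIntersectingIn : ∀ {N n} → ℕ → (Fin N → Fin n) → Family N → Family N → Set
CrossIntersectingIn r c 𝒜 ℬ =
  FamilyInJ r c 𝒜 × FamilyInJ r c ℬ ×
  (∀ A B → T (𝒜 A) → T (ℬ B) → Nonempty (A ∩ B))

familyJ : ∀ {N n} → ℕ → (Fin N → Fin n) → Family N
familyJ r c S = Relation.Nullary.Decidable.⌊ InJ? r c S ⌋

emptyFamily : ∀ {N} → Family N
emptyFamily _ = false

-- Choose a permutation σ of the vertices that maps every vertex to
-- a *different* vertex of the *same* clique (the cyclic successor inside
-- the clique; this is where "at least two vertices" is used).  The
-- preimage map φ(S) = σ⁻¹(S) is a bijection of vertex sets that maps
-- 𝒥^r(G) into itself, and φ(S) is disjoint from S whenever S is
-- independent (u ∈ φ(S) ∩ S would make u and σ u adjacent members of S).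
-- Hence for a cross-intersecting pair, 𝒜 and φ[ℬ] are disjoint
-- subfamilies of 𝒥^r(G), and |φ[ℬ]| = |ℬ| since φ is a bijection.
module Submission where

open import Defs
open import Data.Nat using (ℕ; _≤_; _+_)
open import Data.Fin using (Fin)
open import Data.Product using (_×_)
open import Relation.Binary.PropositionalEquality using (_≡_)

open import Data.Nat using (zero; suc; z≤n; s≤s)
import Data.Nat.Properties as ℕ
open import Data.Fin using (zero; suc; punchOut) renaming (_<_ to _<ᶠ_)
import Data.Fin.Properties as Fin
open import Data.Bool using (Bool; true; false; T)
open import Data.Product using (∃; _,_; proj₁; proj₂)
open import Data.Sum using (_⊎_; inj₁; inj₂)
open import Data.Empty using (⊥; ⊥-elim)
open import Data.Unit using (tt)
open import Function using (_∘_; id)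
open import Function.Bundles using (mk⇔)
open import Function.Definitions using (Injective)
open import Relation.Nullary using (Dec; yes; no; ¬_)
open import Relation.Nullary.Decidable using (_×-dec_; T?; toWitness; fromWitness)
open import Relation.Binary.PropositionalEquality
  using (_≢_; refl; sym; trans; cong; cong₂; subst; module ≡-Reasoning)
open import Relation.Binary.Definitions using (tri<; tri≈; tri>)
open import Data.List using (List; []; _∷_; map; length; filterᵇ; tabulate; allFin)
open import Data.List.Properties using (filter-≐)
open import Data.List.Membership.Propositional using () renaming (_∈_ to _∈ˡ_)
open import Data.List.Membership.Propositional.Properties using (∈-map⁺; ∈-map⁻; ∈-++⁺ˡ; ∈-++⁺ʳ; ∈-allFin)
open import Data.List.Membership.Propositional.Properties.WithK using (unique∧set⇒bag)
open import Data.List.Relation.Binary.BagAndSetEquality using (∼bag⇒↭)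
open import Data.List.Relation.Binary.Permutation.Propositional using (_↭_)
open import Data.List.Relation.Binary.Permutation.Propositional.Properties using (filter-↭; ↭-length)
open import Data.List.Relation.Unary.Any using (here)
open import Data.List.Relation.Unary.All using ([])
open import Data.List.Relation.Unary.AllPairs using ([]; _∷_)
open import Data.List.Relation.Unary.Unique.Propositional using (Unique)
import Data.List.Relation.Unary.Unique.Propositional.Properties as Unique
import Data.Vec as V
import Data.Vec.Properties as V
open import Data.Fin.Subset using (Subset; _∈_; _∩_; ∣_∣; Nonempty)
open import Data.Fin.Subset.Properties using (x∈p∩q⁻)

Onto : {X : Set} → (X → X) → Set
Onto {X} h = ∀ y → ∃ λ x → h x ≡ y

count : {X : Set} → (X → Bool) → List X → ℕ
count P xs = length (filterᵇ P xs)

count-map : {X Y : Set} (P : X → Bool) (h : Y → X) (ys : List Y) →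
  count P (map h ys) ≡ count (P ∘ h) ys
count-map P h [] = refl
count-map P h (y ∷ ys) with P (h y)
... | true  = cong suc (count-map P h ys)
... | false = count-map P h ys

count-↭ : {X : Set} (P : X → Bool) {xs ys : List X} → xs ↭ ys → count P xs ≡ count P ys
count-↭ P xs↭ys = ↭-length (filter-↭ (T? ∘ P) xs↭ys)

count-none : {X : Set} (xs : List X) → count (λ _ → false) xs ≡ 0
count-none []       = refl
count-none (x ∷ xs) = count-none xs

count-disjoint : {X : Set} (A B J : X → Bool) →
  (∀ x → T (A x) → T (J x)) → (∀ x → T (B x) → T (J x)) →
  (∀ x → T (A x) → T (B x) → ⊥) →
  (xs : List X) → count A xs + count B xs ≤ count J xs
count-disjoint A B J A⊆J B⊆J A∩B=∅ [] = z≤n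
count-disjoint A B J A⊆J B⊆J A∩B=∅ (x ∷ xs)
  with A x | B x | J x | A⊆J x | B⊆J x | A∩B=∅ x
     | count-disjoint A B J A⊆J B⊆J A∩B=∅ xs
... | true  | true  | _     | _   | _   | both | _  = ⊥-elim (both tt tt)
... | true  | false | true  | _   | _   | _    | ih = s≤s ih
... | false | true  | true  | _   | _   | _    | ih
  rewrite ℕ.+-suc (count A xs) (count B xs) = s≤s ih
... | false | false | true  | _   | _   | _    | ih = ℕ.m≤n⇒m≤1+n ih
... | false | false | false | _   | _   | _    | ih = ih
... | true  | false | false | inJ | _   | _    | _  = ⊥-elim (inJ tt)
... | false | true  | false | _   | inJ | _    | _  = ⊥-elim (inJ tt)

map-bijection-↭ : {X : Set} {L : List X} → Unique L → (∀ x → x ∈ˡ L) →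
  (h : X → X) → Injective _≡_ _≡_ h → Onto h → map h L ↭ L
map-bijection-↭ {L = L} unique complete h h-injective h-onto =
  ∼bag⇒↭ (unique∧set⇒bag (Unique.map⁺ h-injective unique) unique
    (λ {y} → mk⇔ (λ _ → complete y) (λ _ → hit y)))
  where
  hit : ∀ y → y ∈ˡ map h L
  hit y with x , hx≡y ← h-onto y = subst (_∈ˡ map h L) hx≡y (∈-map⁺ h (complete x))

count-reindex : {X : Set} {L : List X} → Unique L → (∀ x → x ∈ˡ L) →
  (h : X → X) → Injective _≡_ _≡_ h → Onto h →
  (P : X → Bool) → count (P ∘ h) L ≡ count P L
count-reindex {L = L} unique complete h h-injective h-onto P = begin
  count (P ∘ h) L   ≡⟨ count-map P h L ⟨
  count P (map h L) ≡⟨ count-↭ P (map-bijection-↭ unique complete h h-injective h-onto) ⟩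
  count P L         ∎
  where open ≡-Reasoning

allSubsets-complete : ∀ {N} (S : Subset N) → S ∈ˡ allSubsets N
allSubsets-complete V.[] = here refl
allSubsets-complete {suc N} (true V.∷ S) =
  ∈-++⁺ˡ (∈-map⁺ (true V.∷_) (allSubsets-complete S))
allSubsets-complete {suc N} (false V.∷ S) =
  ∈-++⁺ʳ (map (true V.∷_) (allSubsets N)) (∈-map⁺ (false V.∷_) (allSubsets-complete S))

allSubsets-unique : ∀ N → Unique (allSubsets N)
allSubsets-unique zero    = [] ∷ []
allSubsets-unique (suc N) =
  Unique.++⁺ (Unique.map⁺ V.∷-injectiveʳ (allSubsets-unique N))
             (Unique.map⁺ V.∷-injectiveʳ (allSubsets-unique N)) different-heads
  where
  different-heads : ∀ {S} → ¬ (S ∈ˡ map (true V.∷_) (allSubsets N) × S ∈ˡ map (false V.∷_) (allSubsets N))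
  different-heads (p , q) with ∈-map⁻ (true V.∷_) p | ∈-map⁻ (false V.∷_) q
  ... | _ , _ , refl | _ , _ , ()

∣tabulate∣ : ∀ {N} {X : Set} (P : X → Bool) (g : Fin N → X) →
  ∣ V.tabulate (P ∘ g) ∣ ≡ count P (tabulate g)
∣tabulate∣ {zero}  P g = refl
∣tabulate∣ {suc N} P g with P (g zero)
... | true  = cong suc (∣tabulate∣ P (g ∘ suc))
... | false = ∣tabulate∣ P (g ∘ suc)

preimage : ∀ {N} → (Fin N → Fin N) → Subset N → Subset N
preimage π S = V.tabulate (V.lookup S ∘ π)

lookup-preimage : ∀ {N} (π : Fin N → Fin N) (S : Subset N) v →
  V.lookup (preimage π S) v ≡ V.lookup S (π v)
lookup-preimage π S = V.lookup∘tabulate (V.lookup S ∘ π)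

∈-preimage : ∀ {N} {π : Fin N → Fin N} {S : Subset N} {v} → v ∈ preimage π S → π v ∈ S
∈-preimage {π = π} {S} {v} v∈π⁻¹S =
  V.lookup⇒[]= (π v) S (trans (sym (lookup-preimage π S v)) (V.[]=⇒lookup v∈π⁻¹S))

preimage-inverse : ∀ {N} (π ρ : Fin N → Fin N) → (∀ v → ρ (π v) ≡ v) →
  ∀ S → preimage π (preimage ρ S) ≡ S
preimage-inverse π ρ ρπ≡id S =
  trans (V.tabulate-cong (λ v → trans (lookup-preimage ρ S (π v)) (cong (V.lookup S) (ρπ≡id v))))
        (V.tabulate∘lookup S)

∣preimage∣ : ∀ {N} (π : Fin N → Fin N) → Injective _≡_ _≡_ π → Onto π →
  ∀ S → ∣ preimage π S ∣ ≡ ∣ S ∣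
∣preimage∣ {N} π π-injective π-onto S = begin
  ∣ preimage π S ∣                   ≡⟨ ∣tabulate∣ (V.lookup S ∘ π) id ⟩
  count (V.lookup S ∘ π) (allFin N)
    ≡⟨ count-reindex (Unique.allFin⁺ N) ∈-allFin π π-injective π-onto (V.lookup S) ⟩
  count (V.lookup S) (allFin N)   ≡⟨ ∣tabulate∣ (V.lookup S) id ⟨
  ∣ V.tabulate (V.lookup S) ∣      ≡⟨ cong ∣_∣ (V.tabulate∘lookup S) ⟩
  ∣ S ∣                            ∎
  where open ≡-Reasoning

module CliqueShift {N n} (c : Fin N → Fin n) (π : Fin N → Fin N)
  (π-injective : Injective _≡_ _≡_ π) (π-onto : Onto π)
  (π-clique : ∀ v → c (π v) ≡ c v) where

  -- π is a graph automorphism, so preimages keep independent r-sets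
  -- independent r-sets.
  preimage-InJ : ∀ {r S} → InJ r c S → InJ r c (preimage π S)
  preimage-InJ {r} {S} (independent , ∣S∣≡r) =
    (λ u v u∈ v∈ (u≢v , cu≡cv) → independent (π u) (π v) (∈-preimage u∈) (∈-preimage v∈)
       (u≢v ∘ π-injective , trans (π-clique u) (trans cu≡cv (sym (π-clique v)))))
    , trans (∣preimage∣ π π-injective π-onto S) ∣S∣≡r

  -- If π has no fixed point then u and π u are adjacent, so an
  -- independent set cannot meet its own preimage.
  preimage-disjoint : (∀ v → π v ≢ v) → ∀ {S} → Independent c S →
    ¬ Nonempty (preimage π S ∩ S)
  preimage-disjoint π-moves {S} independent (u , u∈) with x∈p∩q⁻ (preimage π S) S u∈
  ... | u∈π⁻¹S , u∈S = independent (π u) u (∈-preimage u∈π⁻¹S) u∈S (π-moves u , π-clique u)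

size-familyJ : ∀ {N n} r (c : Fin N → Fin n) → size (familyJ r c) ≡ sizeJ r c
size-familyJ {N} r c =
  cong length (filter-≐ (T? ∘ familyJ r c) (InJ? r c) (toWitness , fromWitness) (allSubsets N))

bound-from-disjoint-shift : ∀ {N n} r (c : Fin N → Fin n) (φ ψ : Subset N → Subset N) →
  (∀ S → φ (ψ S) ≡ S) → (∀ S → ψ (φ S) ≡ S) →
  (∀ {S} → InJ r c S → InJ r c (φ S)) →
  (∀ {S} → InJ r c S → ¬ Nonempty (φ S ∩ S)) →
  (𝒜 ℬ : Family N) → CrossIntersectingIn r c 𝒜 ℬ → size 𝒜 + size ℬ ≤ sizeJ r c
bound-from-disjoint-shift {N} r c φ ψ φψ≡id ψφ≡id φ-InJ φ-disjoint 𝒜 ℬ (𝒜⊆J , ℬ⊆J , cross) =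
  begin
    size 𝒜 + size ℬ                         ≡⟨ cong (size 𝒜 +_) size-shifted-ℬ ⟨
    count 𝒜 L + count (ℬ ∘ ψ) L             ≤⟨ count-disjoint 𝒜 (ℬ ∘ ψ) (familyJ r c)
                                                  𝒜-in-J shifted-ℬ-in-J disjoint L ⟩
    size (familyJ r c)                      ≡⟨ size-familyJ r c ⟩
    sizeJ r c                               ∎
  where
  open ℕ.≤-Reasoning

  L : List (Subset N)
  L = allSubsets N

  ψ-injective : Injective _≡_ _≡_ ψ
  ψ-injective {S} {S′} eq = trans (sym (φψ≡id S)) (trans (cong φ eq) (φψ≡id S′))

  size-shifted-ℬ : count (ℬ ∘ ψ) L ≡ size ℬ
  size-shifted-ℬ = count-reindex (allSubsets-unique N) allSubsets-complete
    ψ ψ-injective (λ S → φ S , ψφ≡id S) ℬ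

  𝒜-in-J : ∀ S → T (𝒜 S) → T (familyJ r c S)
  𝒜-in-J S S∈𝒜 = fromWitness (𝒜⊆J S S∈𝒜)

  shifted-ℬ-in-J : ∀ S → T (ℬ (ψ S)) → T (familyJ r c S)
  shifted-ℬ-in-J S ψS∈ℬ = fromWitness (subst (InJ r c) (φψ≡id S) (φ-InJ (ℬ⊆J (ψ S) ψS∈ℬ)))

  disjoint : ∀ S → T (𝒜 S) → T (ℬ (ψ S)) → ⊥
  disjoint S S∈𝒜 ψS∈ℬ = φ-disjoint (ℬ⊆J (ψ S) ψS∈ℬ)
    (subst (λ X → Nonempty (X ∩ ψ S)) (sym (φψ≡id S)) (cross S (ψ S) S∈𝒜 ψS∈ℬ))

injective⇒onto : ∀ {N} (f : Fin N → Fin N) → Injective _≡_ _≡_ f → Onto f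
injective⇒onto {zero}  f f-injective ()
injective⇒onto {suc M} f f-injective y with Fin.any? (λ x → f x Fin.≟ y)
... | yes hit  = hit
... | no  miss = ⊥-elim (ℕ.1+n≰n (Fin.injective⇒≤ squeezed-injective))
  where
  -- If y were missed, f would squeeze Fin (suc M) injectively into Fin M.
  avoids : ∀ x → y ≢ f x
  avoids x y≡fx = miss (x , sym y≡fx)

  squeezed : Fin (suc M) → Fin M
  squeezed x = punchOut (avoids x)

  squeezed-injective : Injective _≡_ _≡_ squeezed
  squeezed-injective eq = f-injective (Fin.punchOut-injective (avoids _) (avoids _) eq)

≮∧≯⇒≡ : ∀ {N} {u v : Fin N} → ¬ u <ᶠ v → ¬ v <ᶠ u → u ≡ v
≮∧≯⇒≡ {u = u} {v} u≮v v≮u with Fin.<-cmp u v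
... | tri< u<v _ _ = ⊥-elim (u≮v u<v)
... | tri≈ _ u≡v _ = u≡v
... | tri> _ _ v<u = ⊥-elim (v≮u v<u)

Least : ∀ {N} → (Fin N → Set) → Fin N → Set
Least Q w = Q w × (∀ w′ → w′ <ᶠ w → ¬ Q w′)

least? : ∀ {N} (Q : Fin N → Set) → (∀ w → Dec (Q w)) → ∃ (Least Q) ⊎ (∀ w → ¬ Q w)
least? {zero}  Q Q? = inj₂ (λ ())
least? {suc N} Q Q? with Q? zero | least? (Q ∘ suc) (Q? ∘ suc)
... | yes Q0 | _ = inj₁ (zero , Q0 , λ _ ())
... | no ¬Q0 | inj₁ (w , Qw , below) = inj₁ (suc w , Qw , below′)
  where
  below′ : ∀ w′ → w′ <ᶠ suc w → ¬ Q w′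
  below′ zero     _         = ¬Q0
  below′ (suc w′) (s≤s w′<w) = below w′ w′<w
... | no ¬Q0 | inj₂ none = inj₂ none′
  where
  none′ : ∀ w → ¬ Q w
  none′ zero    = ¬Q0
  none′ (suc w) = none w

module CyclicSuccessor {N n} (c : Fin N → Fin n) (two : EachCliqueHasTwoVertices c) where

  Above : Fin N → Fin N → Set
  Above u w = u <ᶠ w × c w ≡ c u

  data Successor (u : Fin N) : Fin N → Set where
    step : ∀ {w} → Least (Above u) w → Successor u w
    wrap : ∀ {w} → Least (λ x → c x ≡ c u) w → (∀ x → ¬ Above u x) → Successor u w

  successor : ∀ u → ∃ (Successor u)
  successor u with least? (Above u) (λ w → (u Fin.<? w) ×-dec (c w Fin.≟ c u))
  ... | inj₁ (w , least) = w , step least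
  ... | inj₂ top with least? (λ x → c x ≡ c u) (λ x → c x Fin.≟ c u)
  ...   | inj₁ (w , least) = w , wrap least top
  ...   | inj₂ none        = ⊥-elim (none u refl)

  successor-clique : ∀ {u w} → Successor u w → c w ≡ c u
  successor-clique (step ((_ , cw≡cu) , _)) = cw≡cu
  successor-clique (wrap (cw≡cu , _) _)     = cw≡cu

  alone : ∀ {u} → Least (λ x → c x ≡ c u) u → (∀ x → ¬ Above u x) →
    ∀ x → c x ≡ c u → x ≡ u
  alone (_ , below) top x cx≡cu =
    ≮∧≯⇒≡ (λ x<u → below x x<u cx≡cu) (λ u<x → top x (u<x , cx≡cu))

  -- Since every clique has two vertices, the successor is never u itself.
  successor-moves : ∀ {u w} → Successor u w → w ≢ u
  successor-moves (step ((u<w , _) , _)) refl = Fin.<-irrefl refl u<w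
  successor-moves {u} (wrap least top) refl with two (c u)
  ... | a , b , a≢b , ca≡cu , cb≡cu =
    a≢b (trans (alone least top a ca≡cu) (sym (alone least top b cb≡cu)))

  successor-injective : ∀ {u v w} → Successor u w → Successor v w → u ≡ v
  successor-injective (step ((u<w , cw≡cu) , below-u)) (step ((v<w , cw≡cv) , below-v)) =
    ≮∧≯⇒≡ (λ u<v → below-u _ v<w (u<v , trans (sym cw≡cv) cw≡cu))
          (λ v<u → below-v _ u<w (v<u , trans (sym cw≡cu) cw≡cv))
  successor-injective (step ((u<w , cw≡cu) , _)) (wrap (cw≡cv , below-v) _) =
    ⊥-elim (below-v _ u<w (trans (sym cw≡cu) cw≡cv))
  successor-injective (wrap (cw≡cu , below-u) _) (step ((v<w , cw≡cv) , _)) =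
    ⊥-elim (below-u _ v<w (trans (sym cw≡cv) cw≡cu))
  successor-injective (wrap (cw≡cu , _) top-u) (wrap (cw≡cv , _) top-v) =
    ≮∧≯⇒≡ (λ u<v → top-u _ (u<v , trans (sym cw≡cv) cw≡cu))
          (λ v<u → top-v _ (v<u , trans (sym cw≡cu) cw≡cv))

  σ : Fin N → Fin N
  σ u = proj₁ (successor u)

  σ-clique : ∀ u → c (σ u) ≡ c u
  σ-clique u = successor-clique (proj₂ (successor u))

  σ-moves : ∀ u → σ u ≢ u
  σ-moves u = successor-moves (proj₂ (successor u))

  σ-injective : Injective _≡_ _≡_ σ
  σ-injective {u} {v} σu≡σv =
    successor-injective (proj₂ (successor u)) (subst (Successor v) (sym σu≡σv) (proj₂ (successor v)))

  σ-onto : Onto σ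
  σ-onto = injective⇒onto σ σ-injective

  σ⁻¹ : Fin N → Fin N
  σ⁻¹ v = proj₁ (σ-onto v)

  σ∘σ⁻¹ : ∀ v → σ (σ⁻¹ v) ≡ v
  σ∘σ⁻¹ v = proj₂ (σ-onto v)

  σ⁻¹∘σ : ∀ v → σ⁻¹ (σ v) ≡ v
  σ⁻¹∘σ v = σ-injective (σ∘σ⁻¹ (σ v))

-- Corollary 1.6.  The bound holds for every r.  The pair (𝒥^r(G), ∅) attains it.

corollary1p6 : (n r N : ℕ) → 1 ≤ n → 1 ≤ r → r ≤ n →
    (c : Fin N → Fin n) → EachCliqueHasTwoVertices c →
    ((𝒜 ℬ : Family N) → CrossIntersectingIn r c 𝒜 ℬ →
      size 𝒜 + size ℬ ≤ sizeJ r c)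
    × (CrossIntersectingIn r c (familyJ r c) emptyFamily
      × (size (familyJ r c) + size {N} emptyFamily ≡ sizeJ r c))
corollary1p6 n r N _ _ _ c two = bound , (J-in-J , (λ _ ()) , (λ _ _ _ ())) , extremal-size
  where
  open CyclicSuccessor c two
  open CliqueShift c σ σ-injective σ-onto σ-clique

  bound : (𝒜 ℬ : Family N) → CrossIntersectingIn r c 𝒜 ℬ → size 𝒜 + size ℬ ≤ sizeJ r c
  bound = bound-from-disjoint-shift r c (preimage σ) (preimage σ⁻¹)
    (preimage-inverse σ σ⁻¹ σ⁻¹∘σ) (preimage-inverse σ⁻¹ σ σ∘σ⁻¹)
    preimage-InJ (preimage-disjoint σ-moves ∘ proj₁)

  J-in-J : FamilyInJ r c (familyJ r c)
  J-in-J _ = toWitness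

  extremal-size : size (familyJ r c) + size {N} emptyFamily ≡ sizeJ r c
  extremal-size = trans (cong₂ _+_ (size-familyJ r c) (count-none (allSubsets N))) (ℕ.+-identityʳ _)
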